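{- Let $n\geq 2$, let $M_0$ be a simple matroid on a ground set $E_0$ disjoint from $[n]$, fix $\epsilon_0\in E_0$, and let $M=C_n\oplus M_0$ and $M'=P^n_{\epsilon_0}\oplus S$. Then $\chi_M(t)=\chi_{M'}(t)$.
   Context: The characteristic polynomial of a matroid $N$ is $\chi_N(t)=T_N(1-t,0)$, where $T_N$ is the Tutte polynomial. $C_n$ is the matroid on $[n]=\{1,\dots,n\}$ of rank $n-1$ whose only circuit is $[n]$; $S$ is the rank-one matroid on a single point $p$; $\oplus$ is direct sum. The parallel connection $P^n_{\epsilon_0}$: on $[n]\cup E_0$ identify $1$ with $\epsilon_0$ (other classes singletons), write $\bar q$ for the class of $q$, $\bar X$ for the set of classes of elements of $X$, $\bar E$ for the set of classes; $P^n_{\epsilon_0}$ is the matroid on $\bar E$ whose circuits are the $\bar C$ with $C$ a circuit of $C_n$ or of $M_0$, together with the sets $\overline{C-1}\cup\overline{C'-\epsilon_0}$ with $1\in C$ a circuit of $C_n$ and $\epsilon_0\in C'$ a circuit of $M_0$. -}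

module Defs where

open import Data.Bool using (Bool; true; false; _∧_; _∨_; not)
open import Data.Nat using (ℕ; zero; suc; _∸_; _≤_; pred) renaming (_+_ to _+ℕ_; _⊔_ to _⊔ℕ_)
open import Data.Integer using (ℤ; +_; _+_; _-_; _*_; _^_)
open import Data.Fin using (Fin; zero; suc; _↑ˡ_; _↑ʳ_)
import Data.Fin.Properties as FinP
open import Data.Fin.Subset using (Subset; _⊆_; _∪_; _∩_; ∣_∣; ⁅_⁆; _∈_) renaming (⊥ to ∅ ; ⊤ to Full; _-_ to _∖_)
open import Data.Vec using (Vec; []; _∷_; _++_; take; drop; tabulate; lookup; tail; _[_]≔_)
import Data.Vec.Properties as VecP
import Data.Bool.Properties as BoolP
open import Data.List using (List; []; _∷_; map; foldr; allFin)
open import Data.Bool.ListAction using (any)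
open import Data.Product using (Σ; ∃; _×_; _,_)
open import Relation.Nullary using (¬_)
open import Relation.Nullary.Decidable using (⌊_⌋)
open import Relation.Binary.PropositionalEquality using (_≡_)

allSubsets : (m : ℕ) → List (Subset m)
allSubsets zero = [] ∷ []
allSubsets (suc m) = map (false ∷_) (allSubsets m) Data.List.++ map (true ∷_) (allSubsets m)

_⊆ᵇ_ : ∀ {m} → Subset m → Subset m → Bool
[] ⊆ᵇ [] = true
(x ∷ xs) ⊆ᵇ (y ∷ ys) = ((not x) ∨ y) ∧ (xs ⊆ᵇ ys)

_≡ˢ_ : ∀ {m} → Subset m → Subset m → Bool
X ≡ˢ Y = ⌊ VecP.≡-dec BoolP._≟_ X Y ⌋

isEmpty : ∀ {m} → Subset m → Bool
isEmpty X = X ≡ˢ ∅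

image : ∀ {a b} → (Fin a → Fin b) → Subset a → Subset b
image {a} f X = tabulate λ y → any (λ x → lookup X x ∧ ⌊ f x FinP.≟ y ⌋) (allFin a)

Circuits : ℕ → Set
Circuits m = Subset m → Bool

record IsMatroid {m : ℕ} (𝒞 : Circuits m) : Set where
  field
    C1 : 𝒞 ∅ ≡ false
    C2 : ∀ C D → 𝒞 C ≡ true → 𝒞 D ≡ true → C ⊆ D → C ≡ D
    C3 : ∀ C D (e : Fin m) → 𝒞 C ≡ true → 𝒞 D ≡ true → ¬ (C ≡ D) →
         e ∈ (C ∩ D) → ∃ λ F → (𝒞 F ≡ true) × (F ⊆ ((C ∪ D) ∖ e))

-- simple: no loops and no parallel pairs, i.e. every circuit has ≥ 3 elements
Simple : ∀ {m} → Circuits m → Set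
Simple {m} 𝒞 = ∀ C → 𝒞 C ≡ true → 3 ≤ ∣ C ∣

independent : ∀ {m} → Circuits m → Subset m → Bool
independent {m} 𝒞 I = not (any (λ C → 𝒞 C ∧ (C ⊆ᵇ I)) (allSubsets m))

rank : ∀ {m} → Circuits m → Subset m → ℕ
rank {m} 𝒞 A =
  foldr (λ I r → if independent 𝒞 I ∧ (I ⊆ᵇ A) then (∣ I ∣ ⊔ℕ r) else r) 0 (allSubsets m)
  where open import Data.Bool using (if_then_else_)

sumℤ : List ℤ → ℤ
sumℤ = foldr _+_ (+ 0)

tutte : ∀ {m} → Circuits m → ℤ → ℤ → ℤ
tutte {m} 𝒞 x y =
  sumℤ (map (λ A → ((x - + 1) ^ (rank 𝒞 Full ∸ rank 𝒞 A))
                 * ((y - + 1) ^ (∣ A ∣ ∸ rank 𝒞 A))) (allSubsets m))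

χ : ∀ {m} → Circuits m → ℤ → ℤ
χ 𝒞 t = tutte 𝒞 (+ 1 - t) (+ 0)

Cn : (n : ℕ) → Circuits n
Cn n C = C ≡ˢ Full

S : Circuits 1
S _ = false

_⊕_ : ∀ {a b} → Circuits a → Circuits b → Circuits (a +ℕ b)
_⊕_ {a} {b} 𝒞₁ 𝒞₂ C =
  (𝒞₁ (take a C) ∧ isEmpty (drop a C)) ∨ (isEmpty (take a C) ∧ 𝒞₂ (drop a C))

-- Parallel connection P^n_{ε₀} of C_n (element 1 = zero of Fin n) and M₀
-- (on E₀ = Fin k) identifying 1 with ε₀.  The set of classes Ē is
-- Fin (pred n + k): left part = classes of 2..n, right part = classes of
-- elements of E₀ (the class of ε₀ being {1, ε₀}).
-- barL / barR send an element of [n] / E₀ to its class.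
barL : ∀ {n k} → Fin k → Fin n → Fin (pred n +ℕ k)
barL {suc n'} ε₀ zero = n' ↑ʳ ε₀
barL {suc n'} {k} ε₀ (suc i) = i ↑ˡ k

barR : ∀ {n k} → Fin k → Fin (pred n +ℕ k)
barR {n} j = pred n ↑ʳ j

minus1 : ∀ {n} → Subset n → Subset n
minus1 [] = []
minus1 (_ ∷ X) = false ∷ X

P : (n k : ℕ) → Circuits k → Fin k → Circuits (pred n +ℕ k)
P n k M₀ ε₀ D =
     any (λ C → Cn n C ∧ (D ≡ˢ image (barL ε₀) C)) (allSubsets n)
  ∨ any (λ C → M₀ C ∧ (D ≡ˢ image (barR {n}) C)) (allSubsets k)
  ∨ any (λ C → Cn n C ∧ lookup' C
          ∧ any (λ C' → M₀ C' ∧ lookup C' ε₀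
                   ∧ (D ≡ˢ (image (barL ε₀) (minus1 C) ∪ image (barR {n}) (C' [ ε₀ ]≔ false))))
                (allSubsets k))
        (allSubsets n)
  where
    lookup' : ∀ {n} → Subset n → Bool
    lookup' [] = false
    lookup' (x ∷ _) = x

-- Match the subsets b ∷ Z ++ Y of [n] ⊎ E₀ (b for the element 1, Z ⊆ {2, …, n}, Y ⊆ E₀) with
-- the subsets (Z ++ Y) ++ [b] of Ē ⊎ {p}, so that 1 corresponds to p. If Z misses an element
-- of {2, …, n}, a subset of b ∷ Z ++ Y is independent in C_n ⊕ M₀ exactly when the matching
-- subset is independent in P^n_ε₀ ⊕ S, so matching sets have equal rank; the two ground sets
-- have equal rank as well, hence the corank–nullity summands agree. The subsets with
-- Z = {2, …, n} contribute nothing on either side: adding 1 to such a set does not change its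
-- rank in C_n ⊕ M₀, nor does adding ε₀ in P^n_ε₀ ⊕ S, and since y - 1 = -1 the two summands of
-- each such pair cancel.

module Submission where

open import Defs
open import Data.Bool.Base using (Bool; true; false; T; not; _∧_; _∨_; if_then_else_)
open import Data.Bool.Properties using (T-∧; T-∨; T-≡; T-not-≡)
import Data.Bool.Properties as Bool
open import Data.Bool.ListAction using (any)
open import Data.Empty using (⊥-elim)
open import Data.Fin.Base using (Fin; zero; suc; _↑ˡ_; _↑ʳ_)
open import Data.Fin.Subset using (Subset; _⊆_; _∈_; _∉_; ∣_∣; ⁅_⁆; _∪_) renaming (⊥ to ∅; ⊤ to Full)
open import Data.Fin.Subset.Properties
  using (⊆-refl; ⊆-trans; ⊆-antisym; ⊆⊤; ⊥⊆; ∈⊤; ∉⊥; out⊆; in⊆in; s⊆s; drop-∷-⊆; _∈?_;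
         x∈⁅x⁆; x∈⁅y⁆⇒x≡y; p⊆q⇒∣p∣≤∣q∣; ∣p∣≤n; ∣p∣≡n⇒p≡⊤; ∣⊤∣≡n; ∪-identityˡ; ∪-identityʳ)
open import Data.Integer.Base using (ℤ; +_; -1ℤ; _+_; _-_; _*_; _^_; -_)
import Data.Integer.Properties as ℤ
open import Algebra.Properties.CommutativeSemigroup ℤ.+-commutativeSemigroup using (interchange)
open import Data.List.Base using (List; []; _∷_; map; foldr; allFin)
import Data.List.Base as List
import Data.List.Properties as List
import Data.List.Membership.Propositional as List
open import Data.List.Membership.Propositional using (lose)
open import Data.List.Membership.Propositional.Properties using (∈-++⁺ˡ; ∈-++⁺ʳ; ∈-map⁺; ∈-allFin)
import Data.List.Relation.Unary.Any as Any
open import Data.List.Relation.Unary.Any.Properties using (any⁺; any⁻)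
open import Data.Nat.Base using (ℕ; suc; _∸_; _≤_; _<_; z≤n; s≤s) renaming (_+_ to _+ℕ_; _⊔_ to _⊔ℕ_)
import Data.Nat.Properties as ℕ
open import Data.Product.Base using (∃; _×_; _,_; proj₁; proj₂)
open import Data.Sum.Base using (_⊎_; inj₁; inj₂)
open import Data.Vec.Base using ([]; _∷_; _++_; lookup; _[_]=_; here; there; _[_]≔_; take; drop; splitAt)
import Data.Vec.Properties as Vec
open import Function.Base using (_∘_)
open import Function.Bundles using (Equivalence)
open import Relation.Binary.PropositionalEquality
  using (_≡_; _≢_; refl; sym; trans; cong; cong₂; subst; subst₂; module ≡-Reasoning)
open import Relation.Nullary using (¬_; yes; no)
open import Relation.Nullary.Decidable using (toWitness; fromWitness)

open Equivalence using (to; from)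

∈-allSubsets : ∀ {m} (X : Subset m) → X List.∈ allSubsets m
∈-allSubsets [] = Any.here refl
∈-allSubsets {suc m} (false ∷ X) = ∈-++⁺ˡ (∈-map⁺ (false ∷_) (∈-allSubsets X))
∈-allSubsets {suc m} (true ∷ X) = ∈-++⁺ʳ (map (false ∷_) (allSubsets m)) (∈-map⁺ (true ∷_) (∈-allSubsets X))

any-allSubsets⁺ : ∀ {m} (p : Subset m → Bool) {X} → T (p X) → T (any p (allSubsets m))
any-allSubsets⁺ {m} p {X} pX = any⁺ p (lose {xs = allSubsets m} (∈-allSubsets X) pX)

any-allSubsets⁻ : ∀ {m} (p : Subset m → Bool) → T (any p (allSubsets m)) → ∃ (T ∘ p)
any-allSubsets⁻ {m} p h = Any.satisfied (any⁻ p (allSubsets m) h)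

≡ˢ⇒≡ : ∀ {m} {X Y : Subset m} → T (X ≡ˢ Y) → X ≡ Y
≡ˢ⇒≡ {X = X} {Y} = toWitness {a? = Vec.≡-dec Bool._≟_ X Y}

≡⇒≡ˢ : ∀ {m} {X Y : Subset m} → X ≡ Y → T (X ≡ˢ Y)
≡⇒≡ˢ {X = X} {Y} = fromWitness {a? = Vec.≡-dec Bool._≟_ X Y}

⊆ᵇ⇒⊆ : ∀ {m} {X Y : Subset m} → T (X ⊆ᵇ Y) → X ⊆ Y
⊆ᵇ⇒⊆ {X = _ ∷ _} {true ∷ _} h here = here
⊆ᵇ⇒⊆ {X = _ ∷ _} {false ∷ _} () here
⊆ᵇ⇒⊆ {X = x ∷ _} {y ∷ _} h (there i∈) = there (⊆ᵇ⇒⊆ (proj₂ (to (T-∧ {not x ∨ y}) h)) i∈)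

⊆⇒⊆ᵇ : ∀ {m} {X Y : Subset m} → X ⊆ Y → T (X ⊆ᵇ Y)
⊆⇒⊆ᵇ {X = []} {[]} _ = _
⊆⇒⊆ᵇ {X = false ∷ _} {_ ∷ _} X⊆Y = ⊆⇒⊆ᵇ (drop-∷-⊆ X⊆Y)
⊆⇒⊆ᵇ {X = true ∷ _} {_ ∷ _} X⊆Y with X⊆Y here
... | here = ⊆⇒⊆ᵇ (drop-∷-⊆ X⊆Y)

∈⇒T-lookup : ∀ {m} {X : Subset m} {x} → x ∈ X → T (lookup X x)
∈⇒T-lookup x∈X = from T-≡ (Vec.[]=⇒lookup x∈X)

T-lookup⇒∈ : ∀ {m} {X : Subset m} {x} → T (lookup X x) → x ∈ X
T-lookup⇒∈ {X = X} {x} h = Vec.lookup⇒[]= x X (to T-≡ h)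

∈-++ˡ⁺ : ∀ {a b} {X : Subset a} (Y : Subset b) {i} → i ∈ X → i ↑ˡ b ∈ X ++ Y
∈-++ˡ⁺ Y here = here
∈-++ˡ⁺ Y (there i∈X) = there (∈-++ˡ⁺ Y i∈X)

∈-++ʳ⁺ : ∀ {a b} (X : Subset a) {Y : Subset b} {j} → j ∈ Y → a ↑ʳ j ∈ X ++ Y
∈-++ʳ⁺ [] j∈Y = j∈Y
∈-++ʳ⁺ (_ ∷ X) j∈Y = there (∈-++ʳ⁺ X j∈Y)

∈-++ˡ⁻ : ∀ {a b} (X : Subset a) (Y : Subset b) {i} → i ↑ˡ b ∈ X ++ Y → i ∈ X
∈-++ˡ⁻ (_ ∷ _) Y {zero} here = here
∈-++ˡ⁻ (_ ∷ X) Y {suc _} (there i∈) = there (∈-++ˡ⁻ X Y i∈)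

∈-++ʳ⁻ : ∀ {a b} (X : Subset a) (Y : Subset b) {j} → a ↑ʳ j ∈ X ++ Y → j ∈ Y
∈-++ʳ⁻ [] Y j∈ = j∈
∈-++ʳ⁻ (_ ∷ X) Y (there j∈) = ∈-++ʳ⁻ X Y j∈

∈-++⁻ : ∀ {a b} (X : Subset a) (Y : Subset b) {w} → w ∈ X ++ Y →
        (∃ λ i → i ∈ X × i ↑ˡ b ≡ w) ⊎ (∃ λ j → j ∈ Y × a ↑ʳ j ≡ w)
∈-++⁻ [] Y w∈ = inj₂ (_ , w∈ , refl)
∈-++⁻ (_ ∷ _) Y here = inj₁ (zero , here , refl)
∈-++⁻ (_ ∷ X) Y (there w∈) with ∈-++⁻ X Y w∈
... | inj₁ (i , i∈X , refl) = inj₁ (suc i , there i∈X , refl)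
... | inj₂ (j , j∈Y , refl) = inj₂ (j , j∈Y , refl)

++-⊆⁺ : ∀ {a b} {X X′ : Subset a} {Y Y′ : Subset b} → X ⊆ X′ → Y ⊆ Y′ → X ++ Y ⊆ X′ ++ Y′
++-⊆⁺ {X = X} {X′} {Y} {Y′} X⊆X′ Y⊆Y′ w∈ with ∈-++⁻ X Y w∈
... | inj₁ (_ , i∈X , refl) = ∈-++ˡ⁺ Y′ (X⊆X′ i∈X)
... | inj₂ (_ , j∈Y , refl) = ∈-++ʳ⁺ X′ (Y⊆Y′ j∈Y)

++-⊆⁻ : ∀ {a b} {X X′ : Subset a} {Y Y′ : Subset b} → X ++ Y ⊆ X′ ++ Y′ → X ⊆ X′ × Y ⊆ Y′
++-⊆⁻ {X = X} {X′} {Y} {Y′} XY⊆ =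
  (λ i∈X → ∈-++ˡ⁻ X′ Y′ (XY⊆ (∈-++ˡ⁺ Y i∈X))) ,
  (λ j∈Y → ∈-++ʳ⁻ X′ Y′ (XY⊆ (∈-++ʳ⁺ X j∈Y)))

∷≢Full : ∀ {m} {b} {Z : Subset m} → Z ≢ Full → b ∷ Z ≢ Full
∷≢Full Z≢Full bZ≡Full = Z≢Full (Vec.∷-injectiveʳ bZ≡Full)

⁅⁆⊆ : ∀ {m} {X : Subset m} {x} → x ∈ X → ⁅ x ⁆ ⊆ X
⁅⁆⊆ {x = x} x∈X y∈⁅x⁆ rewrite x∈⁅y⁆⇒x≡y x y∈⁅x⁆ = x∈X

∷-⊆⁺ : ∀ {m n} {x y} {X Y : Subset m} {X′ Y′ : Subset n} →
       x ∷ X ⊆ y ∷ Y → X′ ⊆ Y′ → x ∷ X′ ⊆ y ∷ Y′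
∷-⊆⁺ {x = false} _ X′⊆Y′ = out⊆ X′⊆Y′
∷-⊆⁺ {x = true} xX⊆yY X′⊆Y′ with xX⊆yY here
... | here = in⊆in X′⊆Y′

≢Full-⊆ : ∀ {m} {X Y : Subset m} → X ⊆ Y → Y ≢ Full → X ≢ Full
≢Full-⊆ X⊆Y Y≢Full refl = Y≢Full (⊆-antisym ⊆⊤ X⊆Y)

[]≔false⊆ : ∀ {m} (X : Subset m) e → X [ e ]≔ false ⊆ X
[]≔false⊆ (_ ∷ X) zero = out⊆ ⊆-refl
[]≔false⊆ (_ ∷ X) (suc e) = s⊆s ([]≔false⊆ X e)

[]≔false⊆[]≔true : ∀ {m} (X : Subset m) e → X [ e ]≔ false ⊆ X [ e ]≔ true
[]≔false⊆[]≔true (_ ∷ X) zero = out⊆ ⊆-refl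
[]≔false⊆[]≔true (_ ∷ X) (suc e) = s⊆s ([]≔false⊆[]≔true X e)

⊆[]≔true⇒[]≔false⊆[]≔false : ∀ {m} {X Y : Subset m} e → X ⊆ Y [ e ]≔ true → X [ e ]≔ false ⊆ Y [ e ]≔ false
⊆[]≔true⇒[]≔false⊆[]≔false {X = _ ∷ _} {_ ∷ _} zero X⊆ = out⊆ (drop-∷-⊆ X⊆)
⊆[]≔true⇒[]≔false⊆[]≔false {X = _ ∷ _} {_ ∷ _} (suc e) X⊆ =
  ∷-⊆⁺ X⊆ (⊆[]≔true⇒[]≔false⊆[]≔false e (drop-∷-⊆ X⊆))

⊆[]≔true⇒[]≔false⊆ : ∀ {m} {X Y : Subset m} e → X ⊆ Y [ e ]≔ true → X [ e ]≔ false ⊆ Y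
⊆[]≔true⇒[]≔false⊆ {Y = Y} e X⊆ = ⊆-trans (⊆[]≔true⇒[]≔false⊆[]≔false e X⊆) ([]≔false⊆ Y e)

[]≔false⊆⇒⊆[]≔true : ∀ {m} {X Y : Subset m} e → X [ e ]≔ false ⊆ Y → X ⊆ Y [ e ]≔ true
[]≔false⊆⇒⊆[]≔true {X = false ∷ _} {_ ∷ _} zero X⊆ = out⊆ (drop-∷-⊆ X⊆)
[]≔false⊆⇒⊆[]≔true {X = true ∷ _} {_ ∷ _} zero X⊆ = in⊆in (drop-∷-⊆ X⊆)
[]≔false⊆⇒⊆[]≔true {X = _ ∷ _} {_ ∷ _} (suc e) X⊆ =
  ∷-⊆⁺ X⊆ ([]≔false⊆⇒⊆[]≔true e (drop-∷-⊆ X⊆))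

∉⇒[]=false : ∀ {m} {X : Subset m} {e} → e ∉ X → X [ e ]= false
∉⇒[]=false {X = false ∷ _} {zero} _ = here
∉⇒[]=false {X = true ∷ _} {zero} e∉X = ⊥-elim (e∉X here)
∉⇒[]=false {X = _ ∷ _} {suc _} e∉X = there (∉⇒[]=false (e∉X ∘ there))

[]=⇒[]≔≡ : ∀ {m} {X : Subset m} {e b} → X [ e ]= b → X [ e ]≔ b ≡ X
[]=⇒[]≔≡ {X = X} {e} X[e]=b = subst (λ b → X [ e ]≔ b ≡ X) (Vec.[]=⇒lookup X[e]=b) (Vec.[]≔-lookup X e)

∉-[]≔false : ∀ {m} (X : Subset m) e → e ∉ X [ e ]≔ false
∉-[]≔false X e e∈ with Vec.[]=-injective e∈ (Vec.[]≔-updates X e)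
... | ()

∣++∣ : ∀ {a b} (X : Subset a) (Y : Subset b) → ∣ X ++ Y ∣ ≡ ∣ X ∣ +ℕ ∣ Y ∣
∣++∣ [] Y = refl
∣++∣ (false ∷ X) Y = ∣++∣ X Y
∣++∣ (true ∷ X) Y = cong suc (∣++∣ X Y)

∣∷∣≡∣++[]∣ : ∀ {m} b (W : Subset m) → ∣ b ∷ W ∣ ≡ ∣ W ++ b ∷ [] ∣
∣∷∣≡∣++[]∣ b W = begin
  ∣ (b ∷ []) ++ W ∣    ≡⟨ ∣++∣ (b ∷ []) W ⟩
  ∣ b ∷ [] ∣ +ℕ ∣ W ∣   ≡⟨ ℕ.+-comm ∣ b ∷ [] ∣ ∣ W ∣ ⟩
  ∣ W ∣ +ℕ ∣ b ∷ [] ∣   ≡⟨ ∣++∣ W (b ∷ []) ⟨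
  ∣ W ++ b ∷ [] ∣      ∎
  where open ≡-Reasoning

∣[]≔true∣ : ∀ {m} (X : Subset m) e → ∣ X [ e ]≔ true ∣ ≡ suc ∣ X [ e ]≔ false ∣
∣[]≔true∣ (_ ∷ X) zero = refl
∣[]≔true∣ (false ∷ X) (suc e) = ∣[]≔true∣ X e
∣[]≔true∣ (true ∷ X) (suc e) = cong suc (∣[]≔true∣ X e)

∣[]≔true++∣ : ∀ {a b} (X : Subset a) e (Y : Subset b) → ∣ X [ e ]≔ true ++ Y ∣ ≡ suc ∣ X [ e ]≔ false ++ Y ∣
∣[]≔true++∣ {b = b} X e Y =
  subst₂ (λ A B → ∣ A ∣ ≡ suc ∣ B ∣) (Vec.[]≔-++-↑ˡ X Y e) (Vec.[]≔-++-↑ˡ X Y e)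
         (∣[]≔true∣ (X ++ Y) (e ↑ˡ b))

∣++[]≔true∣ : ∀ {a b} (X : Subset a) (Y : Subset b) e → ∣ X ++ Y [ e ]≔ true ∣ ≡ suc ∣ X ++ Y [ e ]≔ false ∣
∣++[]≔true∣ {a} X Y e =
  subst₂ (λ A B → ∣ A ∣ ≡ suc ∣ B ∣) (Vec.[]≔-++-↑ʳ X Y e) (Vec.[]≔-++-↑ʳ X Y e)
         (∣[]≔true∣ (X ++ Y) (a ↑ʳ e))

≢Full⇒∣++∣< : ∀ {a b} {Z : Subset a} {Y : Subset b} → Z ≢ Full → ∣ Z ++ Y ∣ < ∣ Full {a} ++ Y ∣
≢Full⇒∣++∣< {a} {Z = Z} {Y} Z≢Full = begin-strict
  ∣ Z ++ Y ∣             ≡⟨ ∣++∣ Z Y ⟩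
  ∣ Z ∣ +ℕ ∣ Y ∣         <⟨ ℕ.+-monoˡ-< ∣ Y ∣ (ℕ.≤∧≢⇒< (∣p∣≤n Z) (Z≢Full ∘ ∣p∣≡n⇒p≡⊤)) ⟩
  a +ℕ ∣ Y ∣             ≡⟨ cong (_+ℕ ∣ Y ∣) (∣⊤∣≡n a) ⟨
  ∣ Full {a} ∣ +ℕ ∣ Y ∣  ≡⟨ ∣++∣ (Full {a}) Y ⟨
  ∣ Full {a} ++ Y ∣      ∎
  where open ℕ.≤-Reasoning

[]≔false≢Full : ∀ {m} (X : Subset m) e → X [ e ]≔ false ≢ Full
[]≔false≢Full X e X-e≡Full = ∉-[]≔false X e (subst (e ∈_) (sym X-e≡Full) ∈⊤)

∈-image⁺ : ∀ {a b} (f : Fin a → Fin b) {X x} → x ∈ X → f x ∈ image f X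
∈-image⁺ {a} f {X} {x} x∈X = T-lookup⇒∈ (subst T (sym (Vec.lookup∘tabulate _ (f x)))
  (any⁺ _ (lose {xs = allFin a} (∈-allFin x) (from T-∧ (∈⇒T-lookup x∈X , fromWitness refl)))))

∈-image⁻ : ∀ {a b} (f : Fin a → Fin b) X {y} → y ∈ image f X → ∃ λ x → x ∈ X × f x ≡ y
∈-image⁻ {a} f X {y} y∈ with Any.satisfied (any⁻ _ (allFin a) (subst T (Vec.lookup∘tabulate _ y) (∈⇒T-lookup y∈)))
... | x , h with to T-∧ h
...   | x∈X , fx≡y = x , T-lookup⇒∈ x∈X , toWitness fx≡y

Independent : ∀ {m} → Circuits m → Subset m → Set
Independent 𝒞 I = ∀ {C} → T (𝒞 C) → ¬ C ⊆ I

Independent-⊆ : ∀ {m} (𝒞 : Circuits m) {I J} → Independent 𝒞 I → J ⊆ I → Independent 𝒞 J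
Independent-⊆ 𝒞 indI J⊆I c C⊆J = indI c (⊆-trans C⊆J J⊆I)

independent⁺ : ∀ {m} (𝒞 : Circuits m) {I} → Independent 𝒞 I → T (independent 𝒞 I)
independent⁺ {m} 𝒞 {I} indI with any (λ C → 𝒞 C ∧ (C ⊆ᵇ I)) (allSubsets m) in eq
... | false = _
... | true with any-allSubsets⁻ (λ C → 𝒞 C ∧ (C ⊆ᵇ I)) (subst T (sym eq) _)
...   | C , h with to T-∧ h
...     | c , C⊆I = indI c (⊆ᵇ⇒⊆ C⊆I)

independent⁻ : ∀ {m} (𝒞 : Circuits m) {I} → T (independent 𝒞 I) → Independent 𝒞 I
independent⁻ 𝒞 {I} h c C⊆I =
  subst T (to T-not-≡ h) (any-allSubsets⁺ (λ C → 𝒞 C ∧ (C ⊆ᵇ I)) (from T-∧ (c , ⊆⇒⊆ᵇ C⊆I)))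

-- rank 𝒞 A unfolds to maxWhere (λ I → independent 𝒞 I ∧ (I ⊆ᵇ A)) ∣_∣ (allSubsets m).
maxWhere : {A : Set} → (A → Bool) → (A → ℕ) → List A → ℕ
maxWhere p f = foldr (λ x r → if p x then f x ⊔ℕ r else r) 0

maxWhere-upper : ∀ {A : Set} (p : A → Bool) (f : A → ℕ) {x xs} → x List.∈ xs → T (p x) → f x ≤ maxWhere p f xs
maxWhere-upper p f {xs = y ∷ xs} (Any.here refl) px with p y
... | true = ℕ.m≤m⊔n (f y) (maxWhere p f xs)
maxWhere-upper p f {xs = y ∷ xs} (Any.there x∈xs) px with p y
... | true = ℕ.≤-trans (maxWhere-upper p f x∈xs px) (ℕ.m≤n⊔m (f y) (maxWhere p f xs))
... | false = maxWhere-upper p f x∈xs px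

maxWhere-least : ∀ {A : Set} (p : A → Bool) (f : A → ℕ) {n} xs →
                 (∀ {x} → x List.∈ xs → T (p x) → f x ≤ n) → maxWhere p f xs ≤ n
maxWhere-least p f [] bound = z≤n
maxWhere-least p f (y ∷ xs) bound with p y in eq
... | true = ℕ.⊔-lub (bound (Any.here refl) (subst T (sym eq) _)) (maxWhere-least p f xs (bound ∘ Any.there))
... | false = maxWhere-least p f xs (bound ∘ Any.there)

rank-upper : ∀ {m} (𝒞 : Circuits m) {A I} → Independent 𝒞 I → I ⊆ A → ∣ I ∣ ≤ rank 𝒞 A
rank-upper 𝒞 {I = I} indI I⊆A =
  maxWhere-upper _ ∣_∣ (∈-allSubsets I) (from T-∧ (independent⁺ 𝒞 indI , ⊆⇒⊆ᵇ I⊆A))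

rank-least : ∀ {m} (𝒞 : Circuits m) {A n} →
             (∀ {I} → Independent 𝒞 I → I ⊆ A → ∣ I ∣ ≤ n) → rank 𝒞 A ≤ n
rank-least {m} 𝒞 bound = maxWhere-least _ ∣_∣ (allSubsets m) λ {I} _ h →
  bound (independent⁻ 𝒞 (proj₁ (to T-∧ h))) (⊆ᵇ⇒⊆ (proj₂ (to (T-∧ {independent 𝒞 I}) h)))

Dominated : ∀ {a b} → Circuits a → Subset a → Circuits b → Subset b → Set
Dominated 𝒞 A 𝒟 B =
  ∀ I → Independent 𝒞 I → I ⊆ A → ∃ λ J → Independent 𝒟 J × J ⊆ B × ∣ I ∣ ≤ ∣ J ∣

rank-≤ : ∀ {a b} (𝒞 : Circuits a) (𝒟 : Circuits b) {A B} → Dominated 𝒞 A 𝒟 B → rank 𝒞 A ≤ rank 𝒟 B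
rank-≤ 𝒞 𝒟 dominated = rank-least 𝒞 λ {I} indI I⊆A →
  let J , indJ , J⊆B , ∣I∣≤∣J∣ = dominated I indI I⊆A in ℕ.≤-trans ∣I∣≤∣J∣ (rank-upper 𝒟 indJ J⊆B)

rank-mono : ∀ {m} (𝒞 : Circuits m) {A B} → A ⊆ B → rank 𝒞 A ≤ rank 𝒞 B
rank-mono 𝒞 A⊆B = rank-least 𝒞 λ indI I⊆A → rank-upper 𝒞 indI (⊆-trans I⊆A A⊆B)

rank≤∣∣ : ∀ {m} (𝒞 : Circuits m) A → rank 𝒞 A ≤ ∣ A ∣
rank≤∣∣ 𝒞 A = rank-least 𝒞 λ _ → p⊆q⇒∣p∣≤∣q∣

take-++ : ∀ {a b} (X : Subset a) (Y : Subset b) → take a (X ++ Y) ≡ X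
take-++ {a} X Y = proj₁ (Vec.++-injective (take a (X ++ Y)) X (Vec.take++drop≡id a (X ++ Y)))

drop-++ : ∀ {a b} (X : Subset a) (Y : Subset b) → drop a (X ++ Y) ≡ Y
drop-++ {a} X Y = proj₂ (Vec.++-injective (take a (X ++ Y)) X (Vec.take++drop≡id a (X ++ Y)))

module _ {a b} (𝒞₁ : Circuits a) (𝒞₂ : Circuits b) where

  ⊕-circuit : ∀ C D → (𝒞₁ ⊕ 𝒞₂) (C ++ D) ≡ (𝒞₁ C ∧ isEmpty D) ∨ (isEmpty C ∧ 𝒞₂ D)
  ⊕-circuit C D = cong₂ (λ X Y → (𝒞₁ X ∧ isEmpty Y) ∨ (isEmpty X ∧ 𝒞₂ Y)) (take-++ C D) (drop-++ C D)

  ⊕-circuitˡ : ∀ {C} → T (𝒞₁ C) → T ((𝒞₁ ⊕ 𝒞₂) (C ++ ∅))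
  ⊕-circuitˡ {C} c = subst T (sym (⊕-circuit C ∅))
    (from (T-∨ {𝒞₁ C ∧ isEmpty (∅ {b})}) (inj₁ (from T-∧ (c , ≡⇒≡ˢ refl))))

  ⊕-circuitʳ : ∀ {D} → T (𝒞₂ D) → T ((𝒞₁ ⊕ 𝒞₂) (∅ ++ D))
  ⊕-circuitʳ {D} d = subst T (sym (⊕-circuit ∅ D))
    (from (T-∨ {𝒞₁ ∅ ∧ isEmpty D}) (inj₂ (from (T-∧ {isEmpty (∅ {a})}) (≡⇒≡ˢ refl , d))))

  ⊕-circuit⁻ : ∀ CD → T ((𝒞₁ ⊕ 𝒞₂) CD) → T (𝒞₁ (take a CD)) ⊎ T (𝒞₂ (drop a CD))
  ⊕-circuit⁻ CD h with to T-∨ h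
  ... | inj₁ h₁ = inj₁ (proj₁ (to T-∧ h₁))
  ... | inj₂ h₂ = inj₂ (proj₂ (to (T-∧ {isEmpty (take a CD)}) h₂))

  ⊕-independent⁺ : ∀ {X Y} → Independent 𝒞₁ X → Independent 𝒞₂ Y → Independent (𝒞₁ ⊕ 𝒞₂) (X ++ Y)
  ⊕-independent⁺ indX indY {CD} c CD⊆
    with ++-⊆⁻ (subst (_⊆ _) (sym (Vec.take++drop≡id a CD)) CD⊆) | ⊕-circuit⁻ CD c
  ... | C⊆X , _ | inj₁ c₁ = indX c₁ C⊆X
  ... | _ , D⊆Y | inj₂ c₂ = indY c₂ D⊆Y

  ⊕-independent⁻ : ∀ {X Y} → Independent (𝒞₁ ⊕ 𝒞₂) (X ++ Y) → Independent 𝒞₁ X × Independent 𝒞₂ Y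
  ⊕-independent⁻ indXY =
    (λ c C⊆X → indXY (⊕-circuitˡ c) (++-⊆⁺ C⊆X ⊥⊆)) ,
    (λ c D⊆Y → indXY (⊕-circuitʳ c) (++-⊆⁺ ⊥⊆ D⊆Y))

Cn-independent⁺ : ∀ n {X} → X ≢ Full → Independent (Cn n) X
Cn-independent⁺ n X≢Full c Full⊆X with ≡ˢ⇒≡ c
... | refl = X≢Full (⊆-antisym ⊆⊤ Full⊆X)

Cn-independent⁻ : ∀ n {X} → Independent (Cn n) X → X ≢ Full
Cn-independent⁻ n indX refl = indX (≡⇒≡ˢ refl) ⊆-refl

S-independent : ∀ X → Independent S X
S-independent X ()

Σₛ : (n : ℕ) → (Subset n → ℤ) → ℤ
Σₛ n f = sumℤ (map f (allSubsets n))

sumℤ-++ : ∀ xs ys → sumℤ (xs List.++ ys) ≡ sumℤ xs + sumℤ ys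
sumℤ-++ [] ys = sym (ℤ.+-identityˡ (sumℤ ys))
sumℤ-++ (x ∷ xs) ys = trans (cong (_+_ x) (sumℤ-++ xs ys)) (sym (ℤ.+-assoc x (sumℤ xs) (sumℤ ys)))

sumℤ-map-+ : ∀ {A : Set} (f g : A → ℤ) xs → sumℤ (map f xs) + sumℤ (map g xs) ≡ sumℤ (map (λ x → f x + g x) xs)
sumℤ-map-+ f g [] = refl
sumℤ-map-+ f g (x ∷ xs) =
  trans (interchange (f x) (sumℤ (map f xs)) (g x) (sumℤ (map g xs))) (cong (_+_ (f x + g x)) (sumℤ-map-+ f g xs))

sumℤ-map-0 : ∀ {A : Set} (f : A → ℤ) xs → (∀ x → f x ≡ + 0) → sumℤ (map f xs) ≡ + 0
sumℤ-map-0 f [] f≡0 = refl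
sumℤ-map-0 f (x ∷ xs) f≡0 = cong₂ _+_ (f≡0 x) (sumℤ-map-0 f xs f≡0)

Σₛ-cong : ∀ n {f g : Subset n → ℤ} → (∀ X → f X ≡ g X) → Σₛ n f ≡ Σₛ n g
Σₛ-cong n f≗g = cong sumℤ (List.map-cong f≗g (allSubsets n))

Σₛ-+ : ∀ n (f g : Subset n → ℤ) → Σₛ n f + Σₛ n g ≡ Σₛ n (λ X → f X + g X)
Σₛ-+ n f g = sumℤ-map-+ f g (allSubsets n)

Σₛ-0 : ∀ n {f : Subset n → ℤ} → (∀ X → f X ≡ + 0) → Σₛ n f ≡ + 0
Σₛ-0 n {f} = sumℤ-map-0 f (allSubsets n)

Σₛ-∷ : ∀ n (f : Subset (suc n) → ℤ) → Σₛ (suc n) f ≡ Σₛ n (f ∘ (false ∷_)) + Σₛ n (f ∘ (true ∷_))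
Σₛ-∷ n f = begin
  sumℤ (map f (map (false ∷_) Xs List.++ map (true ∷_) Xs))
    ≡⟨ cong sumℤ (List.map-++ f (map (false ∷_) Xs) (map (true ∷_) Xs)) ⟩
  sumℤ (map f (map (false ∷_) Xs) List.++ map f (map (true ∷_) Xs))
    ≡⟨ sumℤ-++ (map f (map (false ∷_) Xs)) (map f (map (true ∷_) Xs)) ⟩
  sumℤ (map f (map (false ∷_) Xs)) + sumℤ (map f (map (true ∷_) Xs))
    ≡⟨ cong₂ (λ xs ys → sumℤ xs + sumℤ ys) (List.map-∘ Xs) (List.map-∘ Xs) ⟨
  Σₛ n (f ∘ (false ∷_)) + Σₛ n (f ∘ (true ∷_)) ∎
  where
  open ≡-Reasoning
  Xs : List (Subset n)
  Xs = allSubsets n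

Σₛ-++ : ∀ a b (f : Subset (a +ℕ b) → ℤ) → Σₛ (a +ℕ b) f ≡ Σₛ a (λ X → Σₛ b (λ Y → f (X ++ Y)))
Σₛ-++ 0 b f = sym (ℤ.+-identityʳ (Σₛ b f))
Σₛ-++ (suc a) b f = begin
  Σₛ (suc a +ℕ b) f
    ≡⟨ Σₛ-∷ (a +ℕ b) f ⟩
  Σₛ (a +ℕ b) (f ∘ (false ∷_)) + Σₛ (a +ℕ b) (f ∘ (true ∷_))
    ≡⟨ cong₂ _+_ (Σₛ-++ a b (f ∘ (false ∷_))) (Σₛ-++ a b (f ∘ (true ∷_))) ⟩
  Σₛ a (λ X → Σₛ b (λ Y → f (false ∷ X ++ Y))) + Σₛ a (λ X → Σₛ b (λ Y → f (true ∷ X ++ Y)))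
    ≡⟨ Σₛ-∷ a (λ X → Σₛ b (λ Y → f (X ++ Y))) ⟨
  Σₛ (suc a) (λ X → Σₛ b (λ Y → f (X ++ Y))) ∎
  where open ≡-Reasoning

Σₛ-cancel : ∀ n (e : Fin n) {f : Subset n → ℤ} →
            (∀ X → f (X [ e ]≔ false) + f (X [ e ]≔ true) ≡ + 0) → Σₛ n f ≡ + 0
Σₛ-cancel (suc n) zero {f} pairs-cancel = begin
  Σₛ (suc n) f                                    ≡⟨ Σₛ-∷ n f ⟩
  Σₛ n (f ∘ (false ∷_)) + Σₛ n (f ∘ (true ∷_))    ≡⟨ Σₛ-+ n (f ∘ (false ∷_)) (f ∘ (true ∷_)) ⟩
  Σₛ n (λ X → f (false ∷ X) + f (true ∷ X))       ≡⟨ Σₛ-0 n (λ X → pairs-cancel (false ∷ X)) ⟩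
  + 0                                             ∎
  where open ≡-Reasoning
Σₛ-cancel (suc n) (suc e) {f} pairs-cancel = begin
  Σₛ (suc n) f
    ≡⟨ Σₛ-∷ n f ⟩
  Σₛ n (f ∘ (false ∷_)) + Σₛ n (f ∘ (true ∷_))
    ≡⟨ cong₂ _+_ (Σₛ-cancel n e (pairs-cancel ∘ (false ∷_))) (Σₛ-cancel n e (pairs-cancel ∘ (true ∷_))) ⟩
  + 0 ∎
  where open ≡-Reasoning

-- tutte 𝒞 x y unfolds to Σₛ m (tutteSummand 𝒞 x y).
tutteSummand : ∀ {m} → Circuits m → ℤ → ℤ → Subset m → ℤ
tutteSummand 𝒞 x y A = ((x - + 1) ^ (rank 𝒞 Full ∸ rank 𝒞 A)) * ((y - + 1) ^ (∣ A ∣ ∸ rank 𝒞 A))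

tutteSummand-cong : ∀ {a b} (𝒞 : Circuits a) (𝒟 : Circuits b) {x y A B} →
                    rank 𝒞 Full ≡ rank 𝒟 Full → rank 𝒞 A ≡ rank 𝒟 B → ∣ A ∣ ≡ ∣ B ∣ →
                    tutteSummand 𝒞 x y A ≡ tutteSummand 𝒟 x y B
tutteSummand-cong 𝒞 𝒟 rE≡rE′ rA≡rB ∣A∣≡∣B∣ rewrite rE≡rE′ | rA≡rB | ∣A∣≡∣B∣ = refl

tutteSummand-cancel : ∀ {m} (𝒞 : Circuits m) x {A B} → rank 𝒞 A ≡ rank 𝒞 B → ∣ B ∣ ≡ suc ∣ A ∣ →
                      tutteSummand 𝒞 x (+ 0) A + tutteSummand 𝒞 x (+ 0) B ≡ + 0
tutteSummand-cancel 𝒞 x {A} rA≡rB ∣B∣≡1+∣A∣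
  rewrite sym rA≡rB | ∣B∣≡1+∣A∣ | ℕ.+-∸-assoc 1 (rank≤∣∣ 𝒞 A) = begin
  a * c + a * (-1ℤ * c)  ≡⟨ cong (λ u → a * c + u) (trans (cong (a *_) (ℤ.-1*i≡-i c)) (sym (ℤ.neg-distribʳ-* a c))) ⟩
  a * c + - (a * c)      ≡⟨ ℤ.+-inverseʳ (a * c) ⟩
  + 0                    ∎
  where
  open ≡-Reasoning
  a c : ℤ
  a = (x - + 1) ^ (rank 𝒞 Full ∸ rank 𝒞 A)
  c = -1ℤ ^ (∣ A ∣ ∸ rank 𝒞 A)

-- Here n = suc m: Z : Subset m stands for a subset of {2, …, n}, and s : Subset 1 for one of {p}.
module ParallelConnection (m : ℕ) {k} (M₀ : Circuits k) (ε : Fin k) where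

  Pε : Circuits (m +ℕ k)
  Pε = P (suc m) k M₀ ε

  M : Circuits (suc m +ℕ k)
  M = Cn (suc m) ⊕ M₀

  M′ : Circuits ((m +ℕ k) +ℕ 1)
  M′ = Pε ⊕ S

  bL : Fin (suc m) → Fin (m +ℕ k)
  bL = barL ε

  bR : Fin k → Fin (m +ℕ k)
  bR = barR {suc m}

  -- The circuits of P^n_ε₀ in these coordinates: the class of [n], the class of a circuit C
  -- of M₀, and the class of ([n] - 1) ∪ (C - ε₀) for a circuit C ∋ ε₀ of M₀.
  data ParallelCircuit : Subset (m +ℕ k) → Set where
    base  : ParallelCircuit (Full {m} ++ ⁅ ε ⁆)
    inM₀  : ∀ {C} → T (M₀ C) → ParallelCircuit (∅ {m} ++ C)
    glued : ∀ {C} → T (M₀ C) → ε ∈ C → ParallelCircuit (Full {m} ++ C [ ε ]≔ false)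

  image-bL-Full : image bL Full ≡ Full {m} ++ ⁅ ε ⁆
  image-bL-Full = ⊆-antisym image⊆ ⊆image
    where
    image⊆ : image bL Full ⊆ Full {m} ++ ⁅ ε ⁆
    image⊆ y∈ with ∈-image⁻ bL Full y∈
    ... | zero , _ , refl = ∈-++ʳ⁺ Full (x∈⁅x⁆ ε)
    ... | suc i , _ , refl = ∈-++ˡ⁺ ⁅ ε ⁆ ∈⊤
    ⊆image : Full {m} ++ ⁅ ε ⁆ ⊆ image bL Full
    ⊆image y∈ with ∈-++⁻ (Full {m}) ⁅ ε ⁆ y∈
    ... | inj₁ (i , _ , refl) = ∈-image⁺ bL {x = suc i} ∈⊤
    ... | inj₂ (j , j∈ , refl) rewrite x∈⁅y⁆⇒x≡y ε j∈ = ∈-image⁺ bL {x = zero} ∈⊤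

  image-bL-minus1 : image bL (minus1 Full) ≡ Full {m} ++ ∅ {k}
  image-bL-minus1 = ⊆-antisym image⊆ ⊆image
    where
    image⊆ : image bL (minus1 Full) ⊆ Full {m} ++ ∅ {k}
    image⊆ y∈ with ∈-image⁻ bL (minus1 Full) y∈
    ... | zero , () , _
    ... | suc i , _ , refl = ∈-++ˡ⁺ ∅ ∈⊤
    ⊆image : Full {m} ++ ∅ {k} ⊆ image bL (minus1 Full)
    ⊆image y∈ with ∈-++⁻ (Full {m}) (∅ {k}) y∈
    ... | inj₁ (i , _ , refl) = ∈-image⁺ bL {x = suc i} (there ∈⊤)
    ... | inj₂ (j , j∈∅ , _) = ⊥-elim (∉⊥ j∈∅)

  image-bR : ∀ C → image bR C ≡ ∅ {m} ++ C
  image-bR C = ⊆-antisym image⊆ ⊆image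
    where
    image⊆ : image bR C ⊆ ∅ {m} ++ C
    image⊆ y∈ with ∈-image⁻ bR C y∈
    ... | j , j∈C , refl = ∈-++ʳ⁺ ∅ j∈C
    ⊆image : ∅ {m} ++ C ⊆ image bR C
    ⊆image y∈ with ∈-++⁻ (∅ {m}) C y∈
    ... | inj₁ (i , i∈∅ , _) = ⊥-elim (∉⊥ i∈∅)
    ... | inj₂ (j , j∈C , refl) = ∈-image⁺ bR j∈C

  image-glued : ∀ C → image bL (minus1 Full) ∪ image bR (C [ ε ]≔ false) ≡ Full {m} ++ C [ ε ]≔ false
  image-glued C = begin
    image bL (minus1 Full) ∪ image bR (C [ ε ]≔ false)
      ≡⟨ cong₂ _∪_ image-bL-minus1 (image-bR (C [ ε ]≔ false)) ⟩
    (Full {m} ++ ∅ {k}) ∪ (∅ {m} ++ C [ ε ]≔ false)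
      ≡⟨ Vec.zipWith-++ _∨_ (Full {m}) (∅ {k}) ∅ (C [ ε ]≔ false) ⟩
    (Full ∪ ∅) ++ (∅ ∪ (C [ ε ]≔ false))
      ≡⟨ cong₂ _++_ (∪-identityʳ (Full {m})) (∪-identityˡ (C [ ε ]≔ false)) ⟩
    Full {m} ++ C [ ε ]≔ false ∎
    where open ≡-Reasoning

  -- The disjuncts of P, named because T is not injective: the implicit arguments of T-∨ and
  -- T-∧ have to be supplied.
  private
    isBase : Subset (m +ℕ k) → Subset (suc m) → Bool
    isBase D C = Cn (suc m) C ∧ (D ≡ˢ image bL C)

    isM₀ : Subset (m +ℕ k) → Subset k → Bool
    isM₀ D C = M₀ C ∧ (D ≡ˢ image bR C)

    isGlued : Subset (m +ℕ k) → Subset (suc m) → Subset k → Bool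
    isGlued D C C′ = M₀ C′ ∧ lookup C′ ε ∧ (D ≡ˢ (image bL (minus1 C) ∪ image bR (C′ [ ε ]≔ false)))

  parallelCircuit⁺ : ∀ {D} → ParallelCircuit D → T (Pε D)
  parallelCircuit⁺ {D} base =
    from (T-∨ {any (isBase D) (allSubsets (suc m))}) (inj₁ (any-allSubsets⁺ (isBase D)
      (from (T-∧ {Cn (suc m) Full}) (≡⇒≡ˢ refl , ≡⇒≡ˢ (sym image-bL-Full)))))
  parallelCircuit⁺ {D} (inM₀ {C} c) =
    from (T-∨ {any (isBase D) (allSubsets (suc m))}) (inj₂ (from (T-∨ {any (isM₀ D) (allSubsets k)})
      (inj₁ (any-allSubsets⁺ (isM₀ D) (from (T-∧ {M₀ C}) (c , ≡⇒≡ˢ (sym (image-bR C))))))))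
  parallelCircuit⁺ {D} (glued {C} c ε∈C) =
    from (T-∨ {any (isBase D) (allSubsets (suc m))}) (inj₂ (from (T-∨ {any (isM₀ D) (allSubsets k)}) (inj₂
      (any-allSubsets⁺ {suc m} _ {Full} (from (T-∧ {Cn (suc m) Full}) (≡⇒≡ˢ refl ,
        any-allSubsets⁺ (isGlued D Full) (from (T-∧ {M₀ C}) (c ,
          from (T-∧ {lookup C ε}) (∈⇒T-lookup ε∈C , ≡⇒≡ˢ (sym (image-glued C)))))))))))

  parallelCircuit⁻ : ∀ {D} → T (Pε D) → ParallelCircuit D
  parallelCircuit⁻ {D} h with to (T-∨ {any (isBase D) (allSubsets (suc m))}) h
  ... | inj₁ h₁ with any-allSubsets⁻ (isBase D) h₁
  ...   | C , h₁′ with to (T-∧ {Cn (suc m) C}) h₁′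
  ...     | C-full , D≡ with ≡ˢ⇒≡ C-full | ≡ˢ⇒≡ D≡
  ...       | refl | refl = subst ParallelCircuit (sym image-bL-Full) base
  parallelCircuit⁻ {D} h | inj₂ h₂₃ with to (T-∨ {any (isM₀ D) (allSubsets k)}) h₂₃
  ... | inj₁ h₂ with any-allSubsets⁻ (isM₀ D) h₂
  ...   | C , h₂′ with to (T-∧ {M₀ C}) h₂′
  ...     | c , D≡ with ≡ˢ⇒≡ D≡
  ...       | refl = subst ParallelCircuit (sym (image-bR C)) (inM₀ c)
  parallelCircuit⁻ {D} h | inj₂ h₂₃ | inj₂ h₃ with any-allSubsets⁻ {suc m} _ h₃
  ... | C , h₃′ with to (T-∧ {Cn (suc m) C}) h₃′
  ...   | C-full , h₃″ with ≡ˢ⇒≡ C-full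
  ...     | refl with any-allSubsets⁻ (isGlued D Full) (proj₂ (to (T-∧ {true}) h₃″))
  ...       | C′ , h′ with to (T-∧ {M₀ C′}) h′
  ...         | c′ , h″ with to (T-∧ {lookup C′ ε}) h″
  ...           | ε∈C′ , D≡ with ≡ˢ⇒≡ D≡
  ...             | refl = subst ParallelCircuit (sym (image-glued C′)) (glued c′ (T-lookup⇒∈ ε∈C′))

  P-independent⁺ : ∀ {Z Y} → Independent M₀ Y → (Z ≡ Full → ε ∉ Y × Independent M₀ (Y [ ε ]≔ true)) →
                   Independent Pε (Z ++ Y)
  P-independent⁺ indY full⇒ c D⊆ with parallelCircuit⁻ c
  ... | base with ++-⊆⁻ {X = Full} D⊆
  ...   | Full⊆Z , ⁅ε⁆⊆Y = proj₁ (full⇒ (⊆-antisym ⊆⊤ Full⊆Z)) (⁅ε⁆⊆Y (x∈⁅x⁆ ε))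
  P-independent⁺ indY full⇒ c D⊆ | inM₀ c₀ = indY c₀ (proj₂ (++-⊆⁻ {X = ∅} D⊆))
  P-independent⁺ indY full⇒ c D⊆ | glued c₀ ε∈C with ++-⊆⁻ {X = Full} D⊆
  ... | Full⊆Z , C-ε⊆Y = proj₂ (full⇒ (⊆-antisym ⊆⊤ Full⊆Z)) c₀ ([]≔false⊆⇒⊆[]≔true ε C-ε⊆Y)

  P-independent⁻ : ∀ {Z Y} → Independent Pε (Z ++ Y) →
                   Independent M₀ Y × (Z ≡ Full → ε ∉ Y × Independent M₀ (Y [ ε ]≔ true))
  P-independent⁻ {Z} {Y} indZY = indY , full⇒
    where
    indY : Independent M₀ Y
    indY c C⊆Y = indZY (parallelCircuit⁺ (inM₀ c)) (++-⊆⁺ ⊥⊆ C⊆Y)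
    full⇒ : Z ≡ Full → ε ∉ Y × Independent M₀ (Y [ ε ]≔ true)
    full⇒ refl = ε∉Y , indY+ε
      where
      ε∉Y : ε ∉ Y
      ε∉Y ε∈Y = indZY (parallelCircuit⁺ base) (++-⊆⁺ ⊆-refl (⁅⁆⊆ ε∈Y))
      indY+ε : Independent M₀ (Y [ ε ]≔ true)
      indY+ε {C} c C⊆ with ε ∈? C
      ... | yes ε∈C = indZY (parallelCircuit⁺ (glued c ε∈C)) (++-⊆⁺ ⊆-refl (⊆[]≔true⇒[]≔false⊆ ε C⊆))
      ... | no ε∉C = indY c (subst (_⊆ Y) ([]=⇒[]≔≡ (∉⇒[]=false ε∉C)) (⊆[]≔true⇒[]≔false⊆ ε C⊆))

  M-independent⁺ : ∀ {b Z Y} → b ∷ Z ≢ Full → Independent M₀ Y → Independent M (b ∷ Z ++ Y)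
  M-independent⁺ bZ≢Full = ⊕-independent⁺ (Cn (suc m)) M₀ (Cn-independent⁺ (suc m) bZ≢Full)

  M-independent⁻ : ∀ {b Z Y} → Independent M (b ∷ Z ++ Y) → b ∷ Z ≢ Full × Independent M₀ Y
  M-independent⁻ indI with ⊕-independent⁻ (Cn (suc m)) M₀ indI
  ... | indbZ , indY = Cn-independent⁻ (suc m) indbZ , indY

  M′-independent⁺ : ∀ {W s} → Independent Pε W → Independent M′ (W ++ s)
  M′-independent⁺ {s = s} indW = ⊕-independent⁺ Pε S indW (S-independent s)

  M′-independent⁻ : ∀ {W s} → Independent M′ (W ++ s) → Independent Pε W
  M′-independent⁻ = proj₁ ∘ ⊕-independent⁻ Pε S

  rank-relabel : ∀ {b Z Y} → Z ≢ Full → rank M (b ∷ Z ++ Y) ≡ rank M′ ((Z ++ Y) ++ b ∷ [])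
  rank-relabel {b} {Z} {Y} Z≢Full = ℕ.≤-antisym (rank-≤ M M′ toM′) (rank-≤ M′ M toM)
    where
    toM′ : Dominated M (b ∷ Z ++ Y) M′ ((Z ++ Y) ++ b ∷ [])
    toM′ (b′ ∷ W) indI I⊆ with splitAt m W
    ... | Z′ , Y′ , refl with ++-⊆⁻ {X = b′ ∷ Z′} I⊆
    ...   | b′Z′⊆bZ , Y′⊆Y =
      (Z′ ++ Y′) ++ b′ ∷ [] ,
      M′-independent⁺ (P-independent⁺ (proj₂ (M-independent⁻ indI))
                                       (⊥-elim ∘ ≢Full-⊆ (drop-∷-⊆ b′Z′⊆bZ) Z≢Full)) ,
      ++-⊆⁺ (++-⊆⁺ (drop-∷-⊆ b′Z′⊆bZ) Y′⊆Y) (∷-⊆⁺ b′Z′⊆bZ ⊆-refl) ,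
      ℕ.≤-reflexive (∣∷∣≡∣++[]∣ b′ (Z′ ++ Y′))
    toM : Dominated M′ ((Z ++ Y) ++ b ∷ []) M (b ∷ Z ++ Y)
    toM I indI I⊆ with splitAt (m +ℕ k) I
    ... | W , b′ ∷ [] , refl with splitAt m W
    ...   | Z′ , Y′ , refl with ++-⊆⁻ {X = Z′ ++ Y′} I⊆
    ...     | Z′Y′⊆ZY , b′⊆b with ++-⊆⁻ {X = Z′} Z′Y′⊆ZY
    ...       | Z′⊆Z , Y′⊆Y =
      b′ ∷ Z′ ++ Y′ ,
      M-independent⁺ (∷≢Full (≢Full-⊆ Z′⊆Z Z≢Full))
                     (proj₁ (P-independent⁻ {Z′} (M′-independent⁻ {Z′ ++ Y′} indI))) ,
      ++-⊆⁺ (∷-⊆⁺ b′⊆b Z′⊆Z) Y′⊆Y ,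
      ℕ.≤-reflexive (sym (∣∷∣≡∣++[]∣ b′ (Z′ ++ Y′)))

  -- An independent set containing all of {2, …, n} is not sent to its relabelling: on the
  -- left it omits 1 and z is traded for p, on the right p is traded for ε₀.
  rank-Full : Fin m → rank M Full ≡ rank M′ Full
  rank-Full z = ℕ.≤-antisym (rank-≤ M M′ toM′) (rank-≤ M′ M toM)
    where
    toM′ : Dominated M Full M′ Full
    toM′ (b′ ∷ W) indI _ with splitAt m W
    ... | Z′ , Y′ , refl with M-independent⁻ {b′} {Z′} indI | Vec.≡-dec Bool._≟_ Z′ Full
    ...   | _ , indY′ | no Z′≢Full =
      (Z′ ++ Y′) ++ b′ ∷ [] ,
      M′-independent⁺ (P-independent⁺ indY′ (⊥-elim ∘ Z′≢Full)) , ⊆⊤ ,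
      ℕ.≤-reflexive (∣∷∣≡∣++[]∣ b′ (Z′ ++ Y′))
    toM′ (true ∷ W) indI _ | Z′ , Y′ , refl | 1Full≢Full , _ | yes refl = ⊥-elim (1Full≢Full refl)
    toM′ (false ∷ W) indI _ | Z′ , Y′ , refl | _ , indY′ | yes refl =
      (Full {m} [ z ]≔ false ++ Y′) ++ true ∷ [] ,
      M′-independent⁺ (P-independent⁺ indY′ (⊥-elim ∘ []≔false≢Full Full z)) , ⊆⊤ , ℕ.≤-reflexive size
      where
      size : ∣ Full {m} ++ Y′ ∣ ≡ ∣ (Full {m} [ z ]≔ false ++ Y′) ++ true ∷ [] ∣
      size = begin
        ∣ Full {m} ++ Y′ ∣                              ≡⟨ cong (λ X → ∣ X ++ Y′ ∣) ([]=⇒[]≔≡ {X = Full} {z} ∈⊤) ⟨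
        ∣ Full {m} [ z ]≔ true ++ Y′ ∣                  ≡⟨ ∣[]≔true++∣ Full z Y′ ⟩
        suc ∣ Full {m} [ z ]≔ false ++ Y′ ∣             ≡⟨ ∣∷∣≡∣++[]∣ true (Full {m} [ z ]≔ false ++ Y′) ⟩
        ∣ (Full {m} [ z ]≔ false ++ Y′) ++ true ∷ [] ∣  ∎
        where open ≡-Reasoning
    toM : Dominated M′ Full M Full
    toM I indI _ with splitAt (m +ℕ k) I
    ... | W , b′ ∷ [] , refl with splitAt m W
    ...   | Z′ , Y′ , refl
          with P-independent⁻ {Z′} (M′-independent⁻ {Z′ ++ Y′} indI) | Vec.≡-dec Bool._≟_ (b′ ∷ Z′) Full
    ...     | indY′ , _ | no b′Z′≢Full =
      b′ ∷ Z′ ++ Y′ , M-independent⁺ b′Z′≢Full indY′ , ⊆⊤ ,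
      ℕ.≤-reflexive (sym (∣∷∣≡∣++[]∣ b′ (Z′ ++ Y′)))
    ...     | _ , full⇒ | yes refl with full⇒ refl
    ...       | ε∉Y′ , indY′+ε =
      false ∷ Full {m} ++ Y′ [ ε ]≔ true , M-independent⁺ (λ ()) indY′+ε , ⊆⊤ , ℕ.≤-reflexive size
      where
      size : ∣ (Full {m} ++ Y′) ++ true ∷ [] ∣ ≡ ∣ Full {m} ++ Y′ [ ε ]≔ true ∣
      size = begin
        ∣ (Full {m} ++ Y′) ++ true ∷ [] ∣     ≡⟨ ∣∷∣≡∣++[]∣ true (Full {m} ++ Y′) ⟨
        suc ∣ Full {m} ++ Y′ ∣                ≡⟨ cong (λ Y → suc ∣ Full {m} ++ Y ∣) ([]=⇒[]≔≡ (∉⇒[]=false ε∉Y′)) ⟨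
        suc ∣ Full {m} ++ Y′ [ ε ]≔ false ∣   ≡⟨ ∣++[]≔true∣ (Full {m}) Y′ ε ⟨
        ∣ Full {m} ++ Y′ [ ε ]≔ true ∣        ∎
        where open ≡-Reasoning

  -- An independent set containing 1 misses an element of {2, …, n}, so trading 1 for all of
  -- {2, …, n} does not make it smaller.
  rank-toggle-1 : ∀ Y → rank M (false ∷ Full {m} ++ Y) ≡ rank M (true ∷ Full {m} ++ Y)
  rank-toggle-1 Y = ℕ.≤-antisym (rank-mono M (out⊆ ⊆-refl)) (rank-≤ M M drop1)
    where
    drop1 : Dominated M (true ∷ Full {m} ++ Y) M (false ∷ Full {m} ++ Y)
    drop1 (false ∷ W) indI I⊆ = false ∷ W , indI , out⊆ (drop-∷-⊆ I⊆) , ℕ.≤-refl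
    drop1 (true ∷ W) indI I⊆ with splitAt m W
    ... | Z′ , Y′ , refl with M-independent⁻ {true} {Z′} indI | ++-⊆⁻ {X = true ∷ Z′} I⊆
    ...   | 1Z′≢Full , indY′ | _ , Y′⊆Y =
      false ∷ Full {m} ++ Y′ , M-independent⁺ (λ ()) indY′ , out⊆ (++-⊆⁺ ⊆-refl Y′⊆Y) ,
      ≢Full⇒∣++∣< (1Z′≢Full ∘ cong (true ∷_))

  -- Likewise in P^n_ε₀ ⊕ S: an independent set containing the class of ε₀ misses an element of
  -- {2, …, n}, so trading that class for all of {2, …, n} does not make it smaller.
  rank-toggle-ε : ∀ Y s → rank M′ ((Full {m} ++ Y [ ε ]≔ false) ++ s) ≡ rank M′ ((Full {m} ++ Y [ ε ]≔ true) ++ s)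
  rank-toggle-ε Y s = ℕ.≤-antisym
    (rank-mono M′ (++-⊆⁺ (++-⊆⁺ (⊆-refl {x = Full}) ([]≔false⊆[]≔true Y ε)) (⊆-refl {x = s})))
    (rank-≤ M′ M′ dropε)
    where
    dropε : Dominated M′ ((Full {m} ++ Y [ ε ]≔ true) ++ s) M′ ((Full {m} ++ Y [ ε ]≔ false) ++ s)
    dropε I indI I⊆ with splitAt (m +ℕ k) I
    ... | W , s′ , refl with splitAt m W
    ...   | Z′ , Y′ , refl
          with ++-⊆⁻ {X = Z′ ++ Y′} I⊆ | P-independent⁻ {Z′} (M′-independent⁻ {Z′ ++ Y′} indI)
    ...     | Z′Y′⊆ , s′⊆s | indY′ , full⇒ with ++-⊆⁻ {X = Z′} Z′Y′⊆ | ε ∈? Y′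
    ...       | _ , Y′⊆Y+ε | no ε∉Y′ =
      (Z′ ++ Y′) ++ s′ , indI , ++-⊆⁺ (++-⊆⁺ ⊆⊤ Y′⊆Y-ε) s′⊆s , ℕ.≤-refl
      where
      Y′⊆Y-ε : Y′ ⊆ Y [ ε ]≔ false
      Y′⊆Y-ε = subst (_⊆ _) ([]=⇒[]≔≡ (∉⇒[]=false ε∉Y′)) (⊆[]≔true⇒[]≔false⊆[]≔false ε Y′⊆Y+ε)
    ...       | _ , Y′⊆Y+ε | yes ε∈Y′ =
      (Full {m} ++ Y′ [ ε ]≔ false) ++ s′ ,
      M′-independent⁺ {Full ++ Y′ [ ε ]≔ false}
        (P-independent⁺ {Full} (Independent-⊆ M₀ indY′ ([]≔false⊆ Y′ ε))
                               (λ _ → ∉-[]≔false Y′ ε , subst (Independent M₀) (sym Y′-ε+ε≡Y′) indY′)) ,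
      ++-⊆⁺ (++-⊆⁺ ⊆-refl (⊆[]≔true⇒[]≔false⊆[]≔false ε Y′⊆Y+ε)) s′⊆s ,
      size
      where
      Y′-ε+ε≡Y′ : (Y′ [ ε ]≔ false) [ ε ]≔ true ≡ Y′
      Y′-ε+ε≡Y′ = trans (Vec.[]≔-idempotent Y′ ε) ([]=⇒[]≔≡ ε∈Y′)
      Z′≢Full : Z′ ≢ Full
      Z′≢Full Z′≡Full = proj₁ (full⇒ Z′≡Full) ε∈Y′
      size : ∣ (Z′ ++ Y′) ++ s′ ∣ ≤ ∣ (Full {m} ++ Y′ [ ε ]≔ false) ++ s′ ∣
      size = begin
        ∣ (Z′ ++ Y′) ++ s′ ∣                         ≡⟨ ∣++∣ (Z′ ++ Y′) s′ ⟩
        ∣ Z′ ++ Y′ ∣ +ℕ ∣ s′ ∣                       ≡⟨ cong (λ Y → ∣ Z′ ++ Y ∣ +ℕ ∣ s′ ∣) ([]=⇒[]≔≡ ε∈Y′) ⟨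
        ∣ Z′ ++ Y′ [ ε ]≔ true ∣ +ℕ ∣ s′ ∣           ≡⟨ cong (_+ℕ ∣ s′ ∣) (∣++[]≔true∣ Z′ Y′ ε) ⟩
        suc ∣ Z′ ++ Y′ [ ε ]≔ false ∣ +ℕ ∣ s′ ∣      ≤⟨ ℕ.+-monoˡ-≤ ∣ s′ ∣ (≢Full⇒∣++∣< Z′≢Full) ⟩
        ∣ Full {m} ++ Y′ [ ε ]≔ false ∣ +ℕ ∣ s′ ∣    ≡⟨ ∣++∣ (Full {m} ++ Y′ [ ε ]≔ false) s′ ⟨
        ∣ (Full {m} ++ Y′ [ ε ]≔ false) ++ s′ ∣      ∎
        where open ℕ.≤-Reasoning

  module _ (x : ℤ) where

    private
      τ : Subset (suc m +ℕ k) → ℤ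
      τ = tutteSummand M x (+ 0)

      τ′ : Subset ((m +ℕ k) +ℕ 1) → ℤ
      τ′ = tutteSummand M′ x (+ 0)

    Full-slice-M : Σₛ k (λ Y → τ (false ∷ Full ++ Y) + τ (true ∷ Full ++ Y)) ≡ + 0
    Full-slice-M = Σₛ-0 k λ Y → tutteSummand-cancel M x (rank-toggle-1 Y) refl

    Full-slice-M′ : Σₛ k (λ Y → Σₛ 1 (λ s → τ′ ((Full ++ Y) ++ s))) ≡ + 0
    Full-slice-M′ = Σₛ-cancel k ε λ Y → begin
      Σₛ 1 (λ s → τ′ ((Full ++ Y [ ε ]≔ false) ++ s)) + Σₛ 1 (λ s → τ′ ((Full ++ Y [ ε ]≔ true) ++ s))
        ≡⟨ Σₛ-+ 1 (λ s → τ′ ((Full ++ Y [ ε ]≔ false) ++ s)) (λ s → τ′ ((Full ++ Y [ ε ]≔ true) ++ s)) ⟩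
      Σₛ 1 (λ s → τ′ ((Full ++ Y [ ε ]≔ false) ++ s) + τ′ ((Full ++ Y [ ε ]≔ true) ++ s))
        ≡⟨ Σₛ-0 1 (λ s → tutteSummand-cancel M′ x (rank-toggle-ε Y s) (size Y s)) ⟩
      + 0 ∎
      where
      open ≡-Reasoning
      size : ∀ Y s → ∣ (Full {m} ++ Y [ ε ]≔ true) ++ s ∣ ≡ suc ∣ (Full {m} ++ Y [ ε ]≔ false) ++ s ∣
      size Y s = begin
        ∣ (Full {m} ++ Y [ ε ]≔ true) ++ s ∣        ≡⟨ ∣++∣ (Full {m} ++ Y [ ε ]≔ true) s ⟩
        ∣ Full {m} ++ Y [ ε ]≔ true ∣ +ℕ ∣ s ∣      ≡⟨ cong (_+ℕ ∣ s ∣) (∣++[]≔true∣ (Full {m}) Y ε) ⟩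
        suc ∣ Full {m} ++ Y [ ε ]≔ false ∣ +ℕ ∣ s ∣ ≡⟨ cong suc (∣++∣ (Full {m} ++ Y [ ε ]≔ false) s) ⟨
        suc ∣ (Full {m} ++ Y [ ε ]≔ false) ++ s ∣   ∎

    slice : Fin m → ∀ Z → Σₛ k (λ Y → τ (false ∷ Z ++ Y) + τ (true ∷ Z ++ Y)) ≡
                          Σₛ k (λ Y → Σₛ 1 (λ s → τ′ ((Z ++ Y) ++ s)))
    slice z Z with Vec.≡-dec Bool._≟_ Z Full
    ... | yes refl = trans Full-slice-M (sym Full-slice-M′)
    -- Σₛ 1 g computes to g (false ∷ []) + (g (true ∷ []) + + 0).
    ... | no Z≢Full = Σₛ-cong k λ Y →
      cong₂ _+_ (relabel false Y) (trans (relabel true Y) (sym (ℤ.+-identityʳ (τ′ ((Z ++ Y) ++ true ∷ [])))))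
      where
      relabel : ∀ b Y → τ (b ∷ Z ++ Y) ≡ τ′ ((Z ++ Y) ++ b ∷ [])
      relabel b Y = tutteSummand-cong M M′ {x} {+ 0}
        (rank-Full z) (rank-relabel {b} {Z} {Y} Z≢Full) (∣∷∣≡∣++[]∣ b (Z ++ Y))

corollary4p5 : (n : ℕ) → 2 ≤ n → (k : ℕ) → (M₀ : Circuits k) → IsMatroid M₀ → Simple M₀ →
               (ε₀ : Fin k) → (t : ℤ) →
               χ (Cn n ⊕ M₀) t ≡ χ (P n k M₀ ε₀ ⊕ S) t
corollary4p5 (suc (suc m)) (s≤s (s≤s z≤n)) k M₀ _ _ ε₀ t = begin
  χ M t
    ≡⟨ Σₛ-∷ (suc m +ℕ k) τ ⟩
  Σₛ (suc m +ℕ k) (τ ∘ (false ∷_)) + Σₛ (suc m +ℕ k) (τ ∘ (true ∷_))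
    ≡⟨ Σₛ-+ (suc m +ℕ k) (τ ∘ (false ∷_)) (τ ∘ (true ∷_)) ⟩
  Σₛ (suc m +ℕ k) (λ W → τ (false ∷ W) + τ (true ∷ W))
    ≡⟨ Σₛ-++ (suc m) k (λ W → τ (false ∷ W) + τ (true ∷ W)) ⟩
  Σₛ (suc m) (λ Z → Σₛ k (λ Y → τ (false ∷ Z ++ Y) + τ (true ∷ Z ++ Y)))
    ≡⟨ Σₛ-cong (suc m) (slice x zero) ⟩
  Σₛ (suc m) (λ Z → Σₛ k (λ Y → Σₛ 1 (λ s → τ′ ((Z ++ Y) ++ s))))
    ≡⟨ Σₛ-++ (suc m) k (λ W → Σₛ 1 (λ s → τ′ (W ++ s))) ⟨
  Σₛ (suc m +ℕ k) (λ W → Σₛ 1 (λ s → τ′ (W ++ s)))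
    ≡⟨ Σₛ-++ (suc m +ℕ k) 1 τ′ ⟨
  χ M′ t ∎
  where
  open ParallelConnection (suc m) M₀ ε₀
  open ≡-Reasoning
  x : ℤ
  x = + 1 - t
  τ : Subset (suc (suc m) +ℕ k) → ℤ
  τ = tutteSummand M x (+ 0)
  τ′ : Subset ((suc m +ℕ k) +ℕ 1) → ℤ
  τ′ = tutteSummand M′ x (+ 0)
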